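{- (a) For all integers $k\geq 2$ and $n\geq 1$, the path $P_n$ on $n$ vertices is a $\mathsf{TS}_k$-reconfiguration graph. (b) For all integers $k\ge 2$ and $n\geq 3$, the cycle $C_n$ on $n$ vertices is a $\mathsf{TS}_k$-reconfiguration graph.
   Context: All graphs are finite, simple and undirected. An independent set of a graph is a set of pairwise non-adjacent vertices. For a positive integer $k$, $\mathsf{TS}_k(G)$ is the graph whose vertices are the independent sets of $G$ of size exactly $k$, where two such sets $I,J$ are adjacent iff there exist $u,v\in V(G)$ with $I\setminus J=\{u\}$, $J\setminus I=\{v\}$ and $uv\in E(G)$. A graph $F$ is a $\mathsf{TS}_k$-reconfiguration graph if there exists a graph $G$ with $F\simeq \mathsf{TS}_k(G)$. -}

module Defs where

open import Data.Nat using (ℕ; zero; suc)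
open import Data.Fin using (Fin; toℕ)
open import Data.Fin.Subset using (Subset; _∈_; _─_; ⁅_⁆; ∣_∣)
open import Data.Product using (Σ; ∃; ∃-syntax; _×_; _,_)
open import Data.Sum using (_⊎_)
open import Relation.Binary.PropositionalEquality using (_≡_)
open import Relation.Nullary using (¬_)

record Graph (n : ℕ) : Set₁ where
  field
    Adj   : Fin n → Fin n → Set
    sym   : ∀ {u v} → Adj u v → Adj v u
    irrefl : ∀ {u} → ¬ Adj u u
open Graph public

Independent : ∀ {m} → Graph m → Subset m → Set
Independent G I = ∀ u v → u ∈ I → v ∈ I → ¬ Adj G u v

IsTSVertex : ∀ {m} → ℕ → Graph m → Subset m → Set
IsTSVertex k G I = Independent G I × ∣ I ∣ ≡ k

TSAdj : ∀ {m} → Graph m → Subset m → Subset m → Set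
TSAdj G I J = ∃[ u ] ∃[ v ] ((I ─ J) ≡ ⁅ u ⁆ × (J ─ I) ≡ ⁅ v ⁆ × Adj G u v)

IsoToTS : ∀ {n m} → (Fin n → Fin n → Set) → ℕ → Graph m → Set
IsoToTS {n} {m} R k G =
  Σ (Fin n → Subset m) λ f →
    (∀ i → IsTSVertex k G (f i)) ×
    (∀ i j → f i ≡ f j → i ≡ j) ×
    (∀ I → IsTSVertex k G I → ∃[ i ] f i ≡ I) ×
    (∀ i j → (R i j → TSAdj G (f i) (f j)) × (TSAdj G (f i) (f j) → R i j))

IsTSReconfGraph : ℕ → (n : ℕ) → (Fin n → Fin n → Set) → Set₁
IsTSReconfGraph k n R = ∃[ m ] Σ (Graph m) λ G → IsoToTS R k G

PathAdj : (n : ℕ) → Fin n → Fin n → Set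
PathAdj n i j = suc (toℕ i) ≡ toℕ j ⊎ suc (toℕ j) ≡ toℕ i

CycleAdj : (n : ℕ) → Fin n → Fin n → Set
CycleAdj n i j =
  PathAdj n i j ⊎ (suc (toℕ i) ≡ n × toℕ j ≡ 0) ⊎ (suc (toℕ j) ≡ n × toℕ i ≡ 0)

-- Let H be a triangle-free graph on h vertices, and let G consist of k isolated
-- vertices together with the complement of H. An independent set of G is a set
-- of isolated vertices plus a clique of H, and cliques of H have at most two
-- vertices; so the independent (k + 2)-sets are exactly "all isolated vertices
-- plus an edge of H". Two of them are TS-adjacent iff the edges share an
-- endpoint c: the swapped vertices a, d are then joined in G, because H has no
-- triangle c a d. Hence TS_{k+2}(G) is the line graph L(H), and the theorem
-- follows from P_n = L(P_{n+1}), C_n = L(C_n) for n ≥ 4 and C_3 = L(K_{1,3}).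
module Submission where

open import Defs hiding (sym)
open import Data.Empty using (⊥-elim)
open import Data.Fin using (Fin; zero; suc; toℕ; inject₁; lower₁; _↑ʳ_)
open import Data.Fin.Properties
  using (toℕ-injective; toℕ-inject₁; toℕ-lower₁; toℕ≤pred[n]; ↑ʳ-injective)
  renaming (suc-injective to Fin-suc-injective; _≟_ to _≟ᶠ_)
open import Data.Fin.Subset
  using (Subset; Nonempty; inside; outside; _∈_; _∉_; _⊆_; _─_; _-_; _∪_; ⁅_⁆; ∣_∣; ⊤; ⊥)
open import Data.Fin.Subset.Properties
  using ( ⊆-antisym; x∈⁅x⁆; x∈⁅y⁆⇒x≡y; x∉⁅y⁆⇒x≢y; x∈p∪q⁻; x∈p∪q⁺; x∈p∧x∉q⇒x∈p─q
        ; ∪-comm; ∪-idem; p─⊥≡p; p─⊤≡⊥; ∣⁅x⁆∣≡1; ∣⊤∣≡n; ∣p∣≤n; ∣p∣≡n⇒p≡⊤; _∈?_ )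
open import Data.Nat using (ℕ; zero; suc; _+_; _∸_; _≤_; z≤n; s≤s; s≤s⁻¹)
open import Data.Nat.Properties
  using ( _≟_; suc-injective; +-cancelˡ-≤; +-cancelʳ-≡; +-monoˡ-≤; m∸n+n≡m; 1+n≰n; 1+n≢n
        ; ≤-trans; ≤-reflexive )
open import Data.Product using (_×_; _,_; proj₁; proj₂; ∃₂; ∃-syntax)
import Data.Product as Product
open import Data.Sum using (_⊎_; inj₁; inj₂; [_,_]′; swap)
import Data.Sum as Sum
open import Data.Vec using ([]; _∷_; _++_; here; there)
import Data.Vec as Vec
open import Data.Vec.Properties using (++-injectiveʳ; zipWith-++)
open import Function using (_∘_)
open import Function.Bundles using (_⇔_; mk⇔; Equivalence)
open import Relation.Binary.Definitions using (Decidable)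
open import Relation.Binary.PropositionalEquality
  using (_≡_; _≢_; refl; sym; trans; cong; cong₂; subst; module ≡-Reasoning)
open import Relation.Nullary using (¬_; yes; no)
open import Relation.Nullary.Decidable using (_⊎-dec_; _×-dec_; ¬?)

x∈p─q⁻ : ∀ {n} {x : Fin n} (p q : Subset n) → x ∈ p ─ q → x ∈ p × x ∉ q
x∈p─q⁻ {x = zero}  (inside ∷ p) (outside ∷ q) here = here , λ ()
x∈p─q⁻ {x = suc x} (_ ∷ p)      (_ ∷ q)       (there x∈p─q) with x∈p─q⁻ p q x∈p─q
... | x∈p , x∉q = there x∈p , λ { (there x∈q) → x∉q x∈q }

nonempty : ∀ {n} (p : Subset n) → 1 ≤ ∣ p ∣ → Nonempty p
nonempty (inside  ∷ p) _     = zero , here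
nonempty (outside ∷ p) 1≤∣p∣ with nonempty p 1≤∣p∣
... | x , x∈p = suc x , there x∈p

∣p∣≡1+∣p-x∣ : ∀ {n} {x : Fin n} (p : Subset n) → x ∈ p → ∣ p ∣ ≡ suc ∣ p - x ∣
∣p∣≡1+∣p-x∣ {x = zero}  (inside  ∷ p) here        = cong suc (sym (cong ∣_∣ (p─⊥≡p p)))
∣p∣≡1+∣p-x∣ {x = suc x} (inside  ∷ p) (there x∈p) = cong suc (∣p∣≡1+∣p-x∣ p x∈p)
∣p∣≡1+∣p-x∣ {x = suc x} (outside ∷ p) (there x∈p) = ∣p∣≡1+∣p-x∣ p x∈p

two-distinct-members : ∀ {n} (p : Subset n) → 2 ≤ ∣ p ∣ → ∃₂ λ x y → x ∈ p × y ∈ p × x ≢ y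
two-distinct-members p 2≤∣p∣ with nonempty p (≤-trans (s≤s z≤n) 2≤∣p∣)
... | x , x∈p with nonempty (p - x) (s≤s⁻¹ (≤-trans 2≤∣p∣ (≤-reflexive (∣p∣≡1+∣p-x∣ p x∈p))))
...   | y , y∈p-x with x∈p─q⁻ p ⁅ x ⁆ y∈p-x
...     | y∈p , y∉⁅x⁆ = x , y , x∈p , y∈p , x∉⁅y⁆⇒x≢y y∉⁅x⁆ ∘ sym

∣p++q∣ : ∀ {m n} (p : Subset m) (q : Subset n) → ∣ p ++ q ∣ ≡ ∣ p ∣ + ∣ q ∣
∣p++q∣ []            q = refl
∣p++q∣ (inside  ∷ p) q = cong suc (∣p++q∣ p q)
∣p++q∣ (outside ∷ p) q = ∣p++q∣ p q

↑ʳ∈++⁺ : ∀ {m n} (p : Subset m) {q : Subset n} {y} → y ∈ q → m ↑ʳ y ∈ p ++ q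
↑ʳ∈++⁺ []      y∈q = y∈q
↑ʳ∈++⁺ (_ ∷ p) y∈q = there (↑ʳ∈++⁺ p y∈q)

↑ʳ∈++⁻ : ∀ {m n} (p : Subset m) {q : Subset n} {y} → m ↑ʳ y ∈ p ++ q → y ∈ q
↑ʳ∈++⁻ []      y∈q           = y∈q
↑ʳ∈++⁻ (_ ∷ p) (there y∈p++q) = ↑ʳ∈++⁻ p y∈p++q

⁅↑ʳ⁆ : ∀ m {n} (y : Fin n) → ⁅ m ↑ʳ y ⁆ ≡ ⊥ ++ ⁅ y ⁆
⁅↑ʳ⁆ zero    y = refl
⁅↑ʳ⁆ (suc m) y = cong (outside ∷_) (⁅↑ʳ⁆ m y)

pair : ∀ {n} → Fin n → Fin n → Subset n
pair x y = ⁅ x ⁆ ∪ ⁅ y ⁆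

x∈pair : ∀ {n} {x y : Fin n} → x ∈ pair x y
x∈pair {x = x} = x∈p∪q⁺ (inj₁ (x∈⁅x⁆ x))

y∈pair : ∀ {n} {x y : Fin n} → y ∈ pair x y
y∈pair {y = y} = x∈p∪q⁺ (inj₂ (x∈⁅x⁆ y))

∈pair⁻ : ∀ {n} {x y z : Fin n} → z ∈ pair x y → z ≡ x ⊎ z ≡ y
∈pair⁻ {x = x} {y} z∈ with x∈p∪q⁻ ⁅ x ⁆ ⁅ y ⁆ z∈
... | inj₁ z∈⁅x⁆ = inj₁ (x∈⁅y⁆⇒x≡y x z∈⁅x⁆)
... | inj₂ z∈⁅y⁆ = inj₂ (x∈⁅y⁆⇒x≡y y z∈⁅y⁆)

pair⊆ : ∀ {n} {x y : Fin n} {p : Subset n} → x ∈ p → y ∈ p → pair x y ⊆ p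
pair⊆ x∈p y∈p z∈ with ∈pair⁻ z∈
... | inj₁ refl = x∈p
... | inj₂ refl = y∈p

distinct∈pair : ∀ {n} {x y z w : Fin n} → z ∈ pair x y → w ∈ pair x y → z ≢ w →
                 (z ≡ x × w ≡ y) ⊎ (z ≡ y × w ≡ x)
distinct∈pair z∈ w∈ z≢w with ∈pair⁻ z∈ | ∈pair⁻ w∈
... | inj₁ refl | inj₁ refl = ⊥-elim (z≢w refl)
... | inj₁ refl | inj₂ refl = inj₁ (refl , refl)
... | inj₂ refl | inj₁ refl = inj₂ (refl , refl)
... | inj₂ refl | inj₂ refl = ⊥-elim (z≢w refl)

pair─pair : ∀ {n} {x y z : Fin n} → x ≢ y → y ≢ z → pair x y ─ pair x z ≡ ⁅ y ⁆
pair─pair {x = x} {y} {z} x≢y y≢z = ⊆-antisym ⊆⁅y⁆ ⁅y⁆⊆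
  where
  ⊆⁅y⁆ : pair x y ─ pair x z ⊆ ⁅ y ⁆
  ⊆⁅y⁆ w∈ with x∈p─q⁻ (pair x y) (pair x z) w∈
  ... | w∈xy , w∉xz with ∈pair⁻ w∈xy
  ...   | inj₁ refl = ⊥-elim (w∉xz x∈pair)
  ...   | inj₂ refl = x∈⁅x⁆ y
  ⁅y⁆⊆ : ⁅ y ⁆ ⊆ pair x y ─ pair x z
  ⁅y⁆⊆ w∈ with x∈⁅y⁆⇒x≡y y w∈
  ... | refl = x∈p∧x∉q⇒x∈p─q y∈pair ([ x≢y ∘ sym , y≢z ]′ ∘ ∈pair⁻)

∣pair∣≡2 : ∀ {n} {x y : Fin n} → x ≢ y → ∣ pair x y ∣ ≡ 2
∣pair∣≡2 {x = x} {y} x≢y = begin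
  ∣ pair x y ∣                 ≡⟨ ∣p∣≡1+∣p-x∣ (pair x y) x∈pair ⟩
  suc ∣ pair x y ─ ⁅ x ⁆ ∣     ≡⟨ cong (λ q → suc ∣ pair x y ─ q ∣) (sym (∪-idem ⁅ x ⁆)) ⟩
  suc ∣ pair x y ─ pair x x ∣ ≡⟨ cong (suc ∘ ∣_∣) (pair─pair x≢y (x≢y ∘ sym)) ⟩
  suc ∣ ⁅ y ⁆ ∣                 ≡⟨ cong suc (∣⁅x⁆∣≡1 y) ⟩
  2                             ∎
  where open ≡-Reasoning

Adj⇒≢ : ∀ {h} (H : Graph h) {a b} → Adj H a b → a ≢ b
Adj⇒≢ H ab refl = irrefl H ab

TriangleFree : ∀ {h} → Graph h → Set
TriangleFree H = ∀ {a b c} → Adj H a b → Adj H b c → ¬ Adj H c a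

triangleFree-clique≡pair : ∀ {h} {H : Graph h} → TriangleFree H → {p : Subset h} →
  (∀ {a b} → a ∈ p → b ∈ p → a ≢ b → Adj H a b) →
  ∀ {x y} → x ∈ p → y ∈ p → x ≢ y → p ≡ pair x y
triangleFree-clique≡pair triangle-free clique {x = x} {y} x∈p y∈p x≢y =
  ⊆-antisym ⊆pair (pair⊆ x∈p y∈p)
  where
  ⊆pair : ∀ {z} → z ∈ _ → z ∈ pair x y
  ⊆pair {z} z∈p with z ≟ᶠ x | z ≟ᶠ y
  ... | yes refl | _        = x∈pair
  ... | no _     | yes refl = y∈pair
  ... | no z≢x   | no z≢y   =
    ⊥-elim (triangle-free (clique x∈p y∈p x≢y) (clique y∈p z∈p (z≢y ∘ sym)) (clique z∈p x∈p z≢x))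

padComplement : ∀ k {h} → Graph h → Graph (k + h)
padComplement k H = record
  { Adj    = λ u v → ∃₂ λ x y → u ≡ k ↑ʳ x × v ≡ k ↑ʳ y × x ≢ y × ¬ Adj H x y
  ; sym    = λ (x , y , u≡ , v≡ , x≢y , ¬xy) → y , x , v≡ , u≡ , x≢y ∘ sym , ¬xy ∘ Graph.sym H
  ; irrefl = λ (x , y , u≡x , u≡y , x≢y , _) → x≢y (↑ʳ-injective k x y (trans (sym u≡x) u≡y))
  }

SamePair : ∀ {h} → Fin h → Fin h → Fin h → Fin h → Set
SamePair a b c d = (a ≡ c × b ≡ d) ⊎ (a ≡ d × b ≡ c)

record EdgeListing {h} (H : Graph h) (n : ℕ) : Set where
  field
    src tgt     : Fin n → Fin h
    edge        : ∀ i → Adj H (src i) (tgt i)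
    listed-once : ∀ {i j} → SamePair (src i) (tgt i) (src j) (tgt j) → i ≡ j
    listed      : ∀ {a b} → Adj H a b → ∃[ i ] SamePair (src i) (tgt i) a b

  ends : Fin n → Subset h
  ends i = pair (src i) (tgt i)

LineAdj : ∀ {h} {H : Graph h} {n} → EdgeListing H n → Fin n → Fin n → Set
LineAdj L i j = i ≢ j × ∃[ c ] c ∈ ends i × c ∈ ends j
  where open EdgeListing L

module LineGraphAsTS {h} {H : Graph h} (adj? : Decidable (Adj H)) (triangle-free : TriangleFree H)
                     {n} (L : EdgeListing H n) (k : ℕ) where
  open EdgeListing L

  G : Graph (k + h)
  G = padComplement k H

  embed : Fin n → Subset (k + h)
  embed i = ⊤ ++ ends i

  src≢tgt : ∀ i → src i ≢ tgt i
  src≢tgt i = Adj⇒≢ H (edge i)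

  ends-injective : ∀ {i j} → ends i ≡ ends j → i ≡ j
  ends-injective {i} eq =
    listed-once (distinct∈pair (subst (src i ∈_) eq x∈pair) (subst (tgt i ∈_) eq y∈pair) (src≢tgt i))

  ends-of-edge : ∀ {a b} → Adj H a b → ∃[ i ] ends i ≡ pair a b
  ends-of-edge ab with listed ab
  ... | i , inj₁ (refl , refl) = i , refl
  ... | i , inj₂ (refl , refl) = i , ∪-comm ⁅ src i ⁆ ⁅ tgt i ⁆

  ends-from : ∀ {i c} → c ∈ ends i → ∃[ a ] Adj H c a × ends i ≡ pair c a
  ends-from {i} c∈ with ∈pair⁻ c∈
  ... | inj₁ refl = tgt i , edge i , refl
  ... | inj₂ refl = src i , Graph.sym H (edge i) , ∪-comm ⁅ src i ⁆ ⁅ tgt i ⁆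

  embed-independent : ∀ i → Independent G (embed i)
  embed-independent i u v u∈ v∈ (x , y , refl , refl , x≢y , ¬xy)
    with distinct∈pair {x = src i} {tgt i} (↑ʳ∈++⁻ ⊤ u∈) (↑ʳ∈++⁻ ⊤ v∈) x≢y
  ... | inj₁ (refl , refl) = ¬xy (edge i)
  ... | inj₂ (refl , refl) = ¬xy (Graph.sym H (edge i))

  ∣embed∣ : ∀ i → ∣ embed i ∣ ≡ k + 2
  ∣embed∣ i = trans (∣p++q∣ (⊤ {k}) (ends i)) (cong₂ _+_ (∣⊤∣≡n k) (∣pair∣≡2 (src≢tgt i)))

  embed-injective : ∀ i j → embed i ≡ embed j → i ≡ j
  embed-injective i j = ends-injective ∘ ++-injectiveʳ (⊤ {k}) ⊤

  tsVertex-shape : ∀ (xs : Subset k) ys → IsTSVertex (k + 2) G (xs ++ ys) →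
                   xs ≡ ⊤ × ∃₂ λ x y → Adj H x y × ys ≡ pair x y
  tsVertex-shape xs ys (independent , ∣xs++ys∣) =
    let x , y , x∈ , y∈ , x≢y = two-distinct-members ys 2≤∣ys∣
        ys≡xy = triangleFree-clique≡pair {H = H} triangle-free clique x∈ y∈ x≢y
        ∣xs∣+2≡k+2 = trans (cong (∣ xs ∣ +_) (sym (trans (cong ∣_∣ ys≡xy) (∣pair∣≡2 x≢y)))) ∣xs∣+∣ys∣
    in ∣p∣≡n⇒p≡⊤ (+-cancelʳ-≡ 2 ∣ xs ∣ k ∣xs∣+2≡k+2) , x , y , clique x∈ y∈ x≢y , ys≡xy
    where
    ∣xs∣+∣ys∣ : ∣ xs ∣ + ∣ ys ∣ ≡ k + 2
    ∣xs∣+∣ys∣ = trans (sym (∣p++q∣ xs ys)) ∣xs++ys∣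
    2≤∣ys∣ : 2 ≤ ∣ ys ∣
    2≤∣ys∣ = +-cancelˡ-≤ k 2 ∣ ys ∣
               (≤-trans (≤-reflexive (sym ∣xs∣+∣ys∣)) (+-monoˡ-≤ ∣ ys ∣ (∣p∣≤n xs)))
    clique : ∀ {a b} → a ∈ ys → b ∈ ys → a ≢ b → Adj H a b
    clique {a} {b} a∈ b∈ a≢b with adj? a b
    ... | yes ab = ab
    ... | no ¬ab =
      ⊥-elim (independent _ _ (↑ʳ∈++⁺ xs a∈) (↑ʳ∈++⁺ xs b∈) (a , b , refl , refl , a≢b , ¬ab))

  embed-surjective : ∀ I → IsTSVertex (k + 2) G I → ∃[ i ] embed i ≡ I
  embed-surjective I I-vertex with Vec.splitAt k I
  ... | xs , ys , refl with tsVertex-shape xs ys I-vertex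
  ...   | xs≡⊤ , x , y , xy , ys≡xy with ends-of-edge xy
  ...     | i , ends-i = i , cong₂ _++_ (sym xs≡⊤) (trans ends-i (sym ys≡xy))

  embed─embed : ∀ i j → embed i ─ embed j ≡ ⊥ ++ (ends i ─ ends j)
  embed─embed i j = trans (zipWith-++ _ ⊤ (ends i) ⊤ (ends j)) (cong (_++ (ends i ─ ends j)) (p─⊤≡⊥ ⊤))

  embed─embed≡⁅⁆ : ∀ {i j c a d} → ends i ≡ pair c a → ends j ≡ pair c d → c ≢ a → a ≢ d →
                   embed i ─ embed j ≡ ⁅ k ↑ʳ a ⁆
  embed─embed≡⁅⁆ {i} {j} {c} {a} {d} ends-i ends-j c≢a a≢d = begin
    embed i ─ embed j           ≡⟨ embed─embed i j ⟩
    ⊥ ++ (ends i ─ ends j)      ≡⟨ cong (⊥ ++_) (cong₂ _─_ ends-i ends-j) ⟩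
    ⊥ ++ (pair c a ─ pair c d)  ≡⟨ cong (⊥ ++_) (pair─pair c≢a a≢d) ⟩
    ⊥ ++ ⁅ a ⁆                  ≡⟨ sym (⁅↑ʳ⁆ k a) ⟩
    ⁅ k ↑ʳ a ⁆                  ∎
    where open ≡-Reasoning

  LineAdj⇒TSAdj : ∀ {i j} → LineAdj L i j → TSAdj G (embed i) (embed j)
  LineAdj⇒TSAdj {i} {j} (i≢j , c , c∈i , c∈j) with ends-from c∈i | ends-from c∈j
  ... | a , ca , ends-i | d , cd , ends-j =
    k ↑ʳ a , k ↑ʳ d ,
    embed─embed≡⁅⁆ ends-i ends-j (Adj⇒≢ H ca) a≢d ,
    embed─embed≡⁅⁆ ends-j ends-i (Adj⇒≢ H cd) (a≢d ∘ sym) ,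
    a , d , refl , refl , a≢d , λ ad → triangle-free ca ad (Graph.sym H cd)
    where
    a≢d : a ≢ d
    a≢d refl = i≢j (ends-injective (trans ends-i (sym ends-j)))

  TSAdj⇒LineAdj : ∀ {i j} → TSAdj G (embed i) (embed j) → LineAdj L i j
  TSAdj⇒LineAdj {i} {j} (u , _ , i─j≡u , _) = i≢j , shared
    where
    lift≡u : ∀ {x} → x ∈ ends i → x ∉ ends j → k ↑ʳ x ≡ u
    lift≡u x∈i x∉j = x∈⁅y⁆⇒x≡y u (subst (_ ∈_) (trans (sym (embed─embed i j)) i─j≡u)
                                        (↑ʳ∈++⁺ ⊥ (x∈p∧x∉q⇒x∈p─q x∈i x∉j)))
    i≢j : i ≢ j
    i≢j refl with x∈p─q⁻ (embed i) (embed i) (subst (u ∈_) (sym i─j≡u) (x∈⁅x⁆ u))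
    ... | u∈ , u∉ = u∉ u∈
    shared : ∃[ c ] c ∈ ends i × c ∈ ends j
    shared with src i ∈? ends j | tgt i ∈? ends j
    ... | yes src∈ | _        = src i , x∈pair , src∈
    ... | no _     | yes tgt∈ = tgt i , y∈pair , tgt∈
    ... | no src∉  | no tgt∉  =
      ⊥-elim (src≢tgt i (↑ʳ-injective k _ _ (trans (lift≡u x∈pair src∉) (sym (lift≡u y∈pair tgt∉)))))

  lineGraph≅TS : IsoToTS (LineAdj L) (k + 2) G
  lineGraph≅TS = embed , (λ i → embed-independent i , ∣embed∣ i) , embed-injective , embed-surjective ,
                 λ i j → LineAdj⇒TSAdj , TSAdj⇒LineAdj

IsoToTS-resp-⇔ : ∀ {n m} {R R′ : Fin n → Fin n → Set} {k} {G : Graph m} →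
                 (∀ i j → R i j ⇔ R′ i j) → IsoToTS R k G → IsoToTS R′ k G
IsoToTS-resp-⇔ R⇔R′ (f , vertex , injective , surjective , adjacent) =
  f , vertex , injective , surjective , λ i j →
    let open Equivalence (R⇔R′ i j) in proj₁ (adjacent i j) ∘ from , to ∘ proj₂ (adjacent i j)

lineGraph-isTSReconf : ∀ {h} {H : Graph h} → Decidable (Adj H) → TriangleFree H →
  ∀ {n} (L : EdgeListing H n) {R : Fin n → Fin n → Set} → (∀ i j → LineAdj L i j ⇔ R i j) →
  ∀ k → IsTSReconfGraph (k + 2) n R
lineGraph-isTSReconf {h} {H} adj? triangle-free L L⇔R k =
  k + h , padComplement k H ,
  IsoToTS-resp-⇔ {G = padComplement k H} L⇔R (LineGraphAsTS.lineGraph≅TS adj? triangle-free L k)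

-- Every orientation of a triangle is a directed 3-cycle or has two arcs
-- sharing a tail or a head.
module _ {A : Set} {S : A → A → Set}
  (functional : ∀ {x y z} → S x y → S x z → y ≡ z)
  (injective  : ∀ {x y z} → S x z → S y z → x ≡ y)
  (loopless   : ∀ {x} → ¬ S x x)
  (acyclic₃   : ∀ {x y z} → S x y → S y z → ¬ S z x)
  where

  private
    loop : ∀ {x y} → x ≡ y → ¬ S x y
    loop refl = loopless

  symClosure-triangleFree : ∀ {x y z} → S x y ⊎ S y x → S y z ⊎ S z y → ¬ (S z x ⊎ S x z)
  symClosure-triangleFree (inj₁ xy) (inj₁ yz) (inj₁ zx) = acyclic₃ xy yz zx
  symClosure-triangleFree (inj₁ xy) (inj₁ yz) (inj₂ xz) = loop (functional xy xz) yz
  symClosure-triangleFree (inj₁ xy) (inj₂ zy) (inj₁ zx) = loop (functional zx zy) xy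
  symClosure-triangleFree (inj₁ xy) (inj₂ zy) (inj₂ xz) = loop (injective xy zy) xz
  symClosure-triangleFree (inj₂ yx) (inj₁ yz) (inj₁ zx) = loop (functional yz yx) zx
  symClosure-triangleFree (inj₂ yx) (inj₁ yz) (inj₂ xz) = loop (injective yz xz) yx
  symClosure-triangleFree (inj₂ yx) (inj₂ zy) (inj₁ zx) = loop (functional zy zx) yx
  symClosure-triangleFree (inj₂ yx) (inj₂ zy) (inj₂ xz) = acyclic₃ xz zy yx

toℕ≡⇒inject₁≡ : ∀ {n} (i : Fin n) {a} → toℕ i ≡ toℕ a → inject₁ i ≡ a
toℕ≡⇒inject₁≡ i e = toℕ-injective (trans (toℕ-inject₁ i) e)

inject₁≡⇒toℕ≡ : ∀ {n} (i : Fin n) {a} → inject₁ i ≡ a → toℕ i ≡ toℕ a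
inject₁≡⇒toℕ≡ i refl = sym (toℕ-inject₁ i)

pathGraph : ∀ n → Graph n
pathGraph n = record { Adj = PathAdj n ; sym = swap ; irrefl = [ 1+n≢n , 1+n≢n ]′ }

pathGraph-triangleFree : ∀ n → TriangleFree (pathGraph n)
pathGraph-triangleFree n {a} {b} {c} =
  symClosure-triangleFree {S = λ x y → suc x ≡ y}
    (λ { refl refl → refl }) (λ p q → suc-injective (trans p (sym q))) 1+n≢n (λ { refl refl () })
    {toℕ a} {toℕ b} {toℕ c}

PathAdj? : ∀ n → Decidable (PathAdj n)
PathAdj? n a b = (suc (toℕ a) ≟ toℕ b) ⊎-dec (suc (toℕ b) ≟ toℕ a)

pathListing : ∀ n → EdgeListing (pathGraph (suc n)) n
pathListing n = record
  { src = inject₁ ; tgt = suc ; edge = λ i → inj₁ (cong suc (toℕ-inject₁ i))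
  ; listed-once = listed-once ; listed = listed }
  where
  listed-once : ∀ {i j} → SamePair (inject₁ i) (suc i) (inject₁ j) (suc j) → i ≡ j
  listed-once (inj₁ (_ , si≡sj))       = Fin-suc-injective si≡sj
  listed-once {i} {j} (inj₂ (i≡sj , si≡j)) =
    ⊥-elim (no-2-cycle (inject₁≡⇒toℕ≡ i i≡sj) (sym (inject₁≡⇒toℕ≡ j (sym si≡j))))
    where
    no-2-cycle : ∀ {x y} → x ≡ suc y → ¬ suc x ≡ y
    no-2-cycle refl ()
  listed : ∀ {a b} → PathAdj (suc n) a b → ∃[ i ] SamePair (inject₁ i) (suc i) a b
  listed {a} {suc b} (inj₁ sa≡sb) = b , inj₁ (toℕ≡⇒inject₁≡ b (sym (suc-injective sa≡sb)) , refl)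
  listed {suc a} {b} (inj₂ sb≡sa) = a , inj₂ (toℕ≡⇒inject₁≡ a (sym (suc-injective sb≡sa)) , refl)

pathListing-LineAdj⇔PathAdj : ∀ n i j → LineAdj (pathListing n) i j ⇔ PathAdj n i j
pathListing-LineAdj⇔PathAdj n i j = mk⇔ to from
  where
  to : LineAdj (pathListing n) i j → PathAdj n i j
  to (i≢j , c , c∈i , c∈j) with ∈pair⁻ {x = inject₁ i} {suc i} c∈i | ∈pair⁻ {x = inject₁ j} {suc j} c∈j
  ... | inj₁ refl | inj₁ c≡j = ⊥-elim (i≢j (toℕ-injective (trans (inject₁≡⇒toℕ≡ i c≡j) (toℕ-inject₁ j))))
  ... | inj₁ refl | inj₂ c≡j = inj₂ (sym (inject₁≡⇒toℕ≡ i c≡j))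
  ... | inj₂ refl | inj₁ c≡j = inj₁ (sym (inject₁≡⇒toℕ≡ j (sym c≡j)))
  ... | inj₂ refl | inj₂ c≡j = ⊥-elim (i≢j (Fin-suc-injective c≡j))
  from : PathAdj n i j → LineAdj (pathListing n) i j
  from ij = Adj⇒≢ (pathGraph n) ij , shared ij
    where
    shared : PathAdj n i j → ∃[ c ] c ∈ pair (inject₁ i) (suc i) × c ∈ pair (inject₁ j) (suc j)
    shared (inj₁ si≡j) =
      suc i , y∈pair , subst (_∈ pair (inject₁ j) (suc j)) (toℕ≡⇒inject₁≡ j (sym si≡j)) (x∈pair {y = suc j})
    shared (inj₂ sj≡i) =
      suc j , subst (_∈ pair (inject₁ i) (suc i)) (toℕ≡⇒inject₁≡ i (sym sj≡i)) (x∈pair {y = suc i}) , y∈pair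

path-isTSReconf : ∀ n k → IsTSReconfGraph (k + 2) n (PathAdj n)
path-isTSReconf n = lineGraph-isTSReconf (PathAdj? (suc n)) (pathGraph-triangleFree (suc n))
                                         (pathListing n) (pathListing-LineAdj⇔PathAdj n)

-- A graph whose edges are the pairs {a, σ a} (a disjoint union of cycles) is
-- its own line graph.
module _ {h} (H : Graph h) (σ : Fin h → Fin h)
  (edge        : ∀ a → Adj H a (σ a))
  (σ-injective : ∀ {a b} → σ a ≡ σ b → a ≡ b)
  (no-2-cycle  : ∀ a → σ (σ a) ≢ a)
  (oriented    : ∀ {a b} → Adj H a b → σ a ≡ b ⊎ σ b ≡ a)
  where

  successorListing : EdgeListing H h
  successorListing = record
    { src = λ a → a ; tgt = σ ; edge = edge ; listed-once = listed-once ; listed = listed }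
    where
    listed-once : ∀ {a b} → SamePair a (σ a) b (σ b) → a ≡ b
    listed-once (inj₁ (a≡b , _))             = a≡b
    listed-once {b = b} (inj₂ (a≡σb , σa≡b)) = ⊥-elim (no-2-cycle b (trans (cong σ (sym a≡σb)) σa≡b))
    listed : ∀ {a b} → Adj H a b → ∃[ i ] SamePair i (σ i) a b
    listed {a} {b} ab with oriented ab
    ... | inj₁ σa≡b = a , inj₁ (refl , σa≡b)
    ... | inj₂ σb≡a = b , inj₂ (refl , σb≡a)

  successorListing-LineAdj⇔Adj : ∀ a b → LineAdj successorListing a b ⇔ Adj H a b
  successorListing-LineAdj⇔Adj a b = mk⇔ to from
    where
    to : LineAdj successorListing a b → Adj H a b
    to (a≢b , c , c∈a , c∈b) with ∈pair⁻ {x = a} {σ a} c∈a | ∈pair⁻ {x = b} {σ b} c∈b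
    ... | inj₁ refl | inj₁ c≡b  = ⊥-elim (a≢b c≡b)
    ... | inj₁ refl | inj₂ c≡σb = Graph.sym H (subst (Adj H b) (sym c≡σb) (edge b))
    ... | inj₂ refl | inj₁ c≡b  = subst (Adj H a) c≡b (edge a)
    ... | inj₂ refl | inj₂ c≡σb = ⊥-elim (a≢b (σ-injective c≡σb))
    from : Adj H a b → LineAdj successorListing a b
    from ab with oriented ab
    ... | inj₁ σa≡b = Adj⇒≢ H ab , b , subst (_∈ pair a (σ a)) σa≡b y∈pair , x∈pair
    ... | inj₂ σb≡a = Adj⇒≢ H ab , a , x∈pair , subst (_∈ pair b (σ b)) σb≡a y∈pair

-- y follows x in the cyclic order 0, 1, …, m (m is the last vertex, not the length).
CyclicSucc : ℕ → ℕ → ℕ → Set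
CyclicSucc m x y = (m ≡ x × y ≡ 0) ⊎ (m ≢ x × y ≡ suc x)

CyclicSucc-functional : ∀ {m x y z} → CyclicSucc m x y → CyclicSucc m x z → y ≡ z
CyclicSucc-functional (inj₁ (_ , refl))   (inj₁ (_ , refl))   = refl
CyclicSucc-functional (inj₁ (m≡x , _))    (inj₂ (m≢x , _))    = ⊥-elim (m≢x m≡x)
CyclicSucc-functional (inj₂ (m≢x , _))    (inj₁ (m≡x , _))    = ⊥-elim (m≢x m≡x)
CyclicSucc-functional (inj₂ (_ , refl))   (inj₂ (_ , refl))   = refl

CyclicSucc-injective : ∀ {m x y z} → CyclicSucc m x z → CyclicSucc m y z → x ≡ y
CyclicSucc-injective (inj₁ (refl , _)) (inj₁ (refl , _)) = refl
CyclicSucc-injective (inj₁ (_ , refl)) (inj₂ (_ , ()))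
CyclicSucc-injective (inj₂ (_ , refl)) (inj₁ (_ , ()))
CyclicSucc-injective (inj₂ (_ , refl)) (inj₂ (_ , refl)) = refl

CyclicSucc-loopless : ∀ {m x} → 1 ≤ m → ¬ CyclicSucc m x x
CyclicSucc-loopless () (inj₁ (refl , refl))
CyclicSucc-loopless _  (inj₂ (_ , ()))

CyclicSucc-no-2-cycle : ∀ {m x y} → 2 ≤ m → CyclicSucc m x y → ¬ CyclicSucc m y x
CyclicSucc-no-2-cycle ()       (inj₁ (refl , refl)) (inj₁ (refl , refl))
CyclicSucc-no-2-cycle (s≤s ()) (inj₁ (refl , refl)) (inj₂ (_ , refl))
CyclicSucc-no-2-cycle (s≤s ()) (inj₂ (_ , refl))    (inj₁ (refl , refl))
CyclicSucc-no-2-cycle _        (inj₂ (_ , refl))    (inj₂ (_ , ()))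

CyclicSucc-acyclic₃ : ∀ {m x y z} → 3 ≤ m → CyclicSucc m x y → CyclicSucc m y z → ¬ CyclicSucc m z x
CyclicSucc-acyclic₃ ()             (inj₁ (refl , refl)) (inj₁ (refl , _))    _
CyclicSucc-acyclic₃ (s≤s ())       (inj₁ (refl , refl)) (inj₂ (_ , refl))    (inj₁ (refl , _))
CyclicSucc-acyclic₃ (s≤s (s≤s ())) (inj₁ (refl , refl)) (inj₂ (_ , refl))    (inj₂ (_ , refl))
CyclicSucc-acyclic₃ _              (inj₂ (_ , refl))    (inj₁ (refl , refl)) (inj₁ (() , _))
CyclicSucc-acyclic₃ (s≤s (s≤s ())) (inj₂ (_ , refl))    (inj₁ (refl , refl)) (inj₂ (_ , refl))
CyclicSucc-acyclic₃ (s≤s (s≤s ())) (inj₂ (_ , refl))    (inj₂ (_ , refl))    (inj₁ (refl , refl))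
CyclicSucc-acyclic₃ _              (inj₂ (_ , refl))    (inj₂ (_ , refl))    (inj₂ (_ , ()))

CyclicSucc⇒CycleAdj : ∀ {m} {a b : Fin (suc m)} → CyclicSucc m (toℕ a) (toℕ b) → CycleAdj (suc m) a b
CyclicSucc⇒CycleAdj (inj₁ (m≡a , b≡0)) = inj₂ (inj₁ (cong suc (sym m≡a) , b≡0))
CyclicSucc⇒CycleAdj (inj₂ (_ , b≡sa))  = inj₁ (inj₁ (sym b≡sa))

suc≡⇒CyclicSucc : ∀ {m x y} → y ≤ m → suc x ≡ y → CyclicSucc m x y
suc≡⇒CyclicSucc y≤m refl = inj₂ ((λ { refl → 1+n≰n y≤m }) , refl)

CycleAdj⇒CyclicSucc : ∀ {m} {a b : Fin (suc m)} → CycleAdj (suc m) a b →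
                      CyclicSucc m (toℕ a) (toℕ b) ⊎ CyclicSucc m (toℕ b) (toℕ a)
CycleAdj⇒CyclicSucc {b = b} (inj₁ (inj₁ sa≡b)) = inj₁ (suc≡⇒CyclicSucc (toℕ≤pred[n] b) sa≡b)
CycleAdj⇒CyclicSucc {a = a} (inj₁ (inj₂ sb≡a)) = inj₂ (suc≡⇒CyclicSucc (toℕ≤pred[n] a) sb≡a)
CycleAdj⇒CyclicSucc (inj₂ (inj₁ (sa≡sm , b≡0))) = inj₁ (inj₁ (sym (suc-injective sa≡sm) , b≡0))
CycleAdj⇒CyclicSucc (inj₂ (inj₂ (sb≡sm , a≡0))) = inj₂ (inj₁ (sym (suc-injective sb≡sm) , a≡0))

cycleGraph : ∀ m → Graph (2 + m)
cycleGraph m = record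
  { Adj    = CycleAdj (2 + m)
  ; sym    = Sum.map swap swap
  ; irrefl = [ CyclicSucc-loopless 1≤1+m , CyclicSucc-loopless 1≤1+m ]′ ∘ CycleAdj⇒CyclicSucc
  }
  where
  1≤1+m : 1 ≤ suc m
  1≤1+m = s≤s z≤n

CycleAdj? : ∀ n → Decidable (CycleAdj n)
CycleAdj? n a b = PathAdj? n a b ⊎-dec (((suc (toℕ a) ≟ n) ×-dec (toℕ b ≟ 0))
                                 ⊎-dec ((suc (toℕ b) ≟ n) ×-dec (toℕ a ≟ 0)))

cycleGraph-triangleFree : ∀ m → TriangleFree (cycleGraph (2 + m))
cycleGraph-triangleFree m ab bc ca =
  symClosure-triangleFree CyclicSucc-functional CyclicSucc-injective
    (CyclicSucc-loopless (s≤s z≤n)) (CyclicSucc-acyclic₃ {3 + m} (s≤s (s≤s (s≤s z≤n))))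
    (CycleAdj⇒CyclicSucc ab) (CycleAdj⇒CyclicSucc bc) (CycleAdj⇒CyclicSucc ca)

next : ∀ {m} → Fin (suc m) → Fin (suc m)
next {m} i with m ≟ toℕ i
... | yes _   = zero
... | no m≢i = suc (lower₁ i m≢i)

next-CyclicSucc : ∀ {m} (i : Fin (suc m)) → CyclicSucc m (toℕ i) (toℕ (next i))
next-CyclicSucc {m} i with m ≟ toℕ i
... | yes m≡i = inj₁ (m≡i , refl)
... | no m≢i  = inj₂ (m≢i , cong suc (toℕ-lower₁ i m≢i))

CyclicSucc⇒next≡ : ∀ {m} {a b : Fin (suc m)} → CyclicSucc m (toℕ a) (toℕ b) → next a ≡ b
CyclicSucc⇒next≡ {a = a} ab = toℕ-injective (CyclicSucc-functional (next-CyclicSucc a) ab)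

cycle≥4-isTSReconf : ∀ m k → IsTSReconfGraph (k + 2) (4 + m) (CycleAdj (4 + m))
cycle≥4-isTSReconf m =
  lineGraph-isTSReconf (CycleAdj? (4 + m)) (cycleGraph-triangleFree m)
    (successorListing H next edge next-injective next-no-2-cycle oriented)
    (successorListing-LineAdj⇔Adj H next edge next-injective next-no-2-cycle oriented)
  where
  H = cycleGraph (2 + m)
  edge : ∀ a → CycleAdj (4 + m) a (next a)
  edge a = CyclicSucc⇒CycleAdj (next-CyclicSucc a)
  next-injective : ∀ {a b} → next a ≡ next b → a ≡ b
  next-injective {a} {b} eq = toℕ-injective (CyclicSucc-injective (next-CyclicSucc a)
    (subst (CyclicSucc (3 + m) (toℕ b) ∘ toℕ) (sym eq) (next-CyclicSucc b)))
  next-no-2-cycle : ∀ a → next (next a) ≢ a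
  next-no-2-cycle a eq = CyclicSucc-no-2-cycle (s≤s (s≤s z≤n)) (next-CyclicSucc a)
    (subst (CyclicSucc (3 + m) (toℕ (next a)) ∘ toℕ) eq (next-CyclicSucc (next a)))
  oriented : ∀ {a b} → CycleAdj (4 + m) a b → next a ≡ b ⊎ next b ≡ a
  oriented = Sum.map CyclicSucc⇒next≡ CyclicSucc⇒next≡ ∘ CycleAdj⇒CyclicSucc

StarAdj : Fin 4 → Fin 4 → Set
StarAdj a b = (a ≡ zero × b ≢ zero) ⊎ (a ≢ zero × b ≡ zero)

starGraph : Graph 4
starGraph = record
  { Adj    = StarAdj
  ; sym    = [ inj₂ ∘ Product.swap , inj₁ ∘ Product.swap ]′
  ; irrefl = [ (λ (a≡0 , a≢0) → a≢0 a≡0) , (λ (a≢0 , a≡0) → a≢0 a≡0) ]′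
  }

starGraph-triangleFree : TriangleFree starGraph
starGraph-triangleFree (inj₁ (_ , b≢0))   (inj₁ (b≡0 , _))  _                 = b≢0 b≡0
starGraph-triangleFree (inj₁ (a≡0 , _))   (inj₂ _)          (inj₁ (_ , a≢0))  = a≢0 a≡0
starGraph-triangleFree (inj₁ _)           (inj₂ (_ , c≡0))  (inj₂ (c≢0 , _))  = c≢0 c≡0
starGraph-triangleFree (inj₂ _)           (inj₁ (_ , c≢0))  (inj₁ (c≡0 , _))  = c≢0 c≡0
starGraph-triangleFree (inj₂ (a≢0 , _))   (inj₁ _)          (inj₂ (_ , a≡0))  = a≢0 a≡0
starGraph-triangleFree (inj₂ (_ , b≡0))   (inj₂ (b≢0 , _))  _                 = b≢0 b≡0

StarAdj? : Decidable StarAdj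
StarAdj? a b = ((a ≟ᶠ zero) ×-dec ¬? (b ≟ᶠ zero)) ⊎-dec (¬? (a ≟ᶠ zero) ×-dec (b ≟ᶠ zero))

starListing : EdgeListing starGraph 3
starListing = record
  { src = λ _ → zero ; tgt = suc ; edge = λ _ → inj₁ (refl , λ ())
  ; listed-once = λ { (inj₁ (_ , si≡sj)) → Fin-suc-injective si≡sj ; (inj₂ (() , _)) }
  ; listed = listed }
  where
  listed : ∀ {a b} → StarAdj a b → ∃[ i ] SamePair zero (suc i) a b
  listed {b = zero}  (inj₁ (_ , b≢0)) = ⊥-elim (b≢0 refl)
  listed {b = suc b} (inj₁ (refl , _)) = b , inj₁ (refl , refl)
  listed {a = zero}  (inj₂ (a≢0 , _)) = ⊥-elim (a≢0 refl)
  listed {a = suc a} (inj₂ (_ , refl)) = a , inj₂ (refl , refl)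

≢⇒CycleAdj3 : ∀ {i j : Fin 3} → i ≢ j → CycleAdj 3 i j
≢⇒CycleAdj3 {zero}             {zero}             i≢j = ⊥-elim (i≢j refl)
≢⇒CycleAdj3 {zero}             {suc zero}         _   = inj₁ (inj₁ refl)
≢⇒CycleAdj3 {zero}             {suc (suc zero)}   _   = inj₂ (inj₂ (refl , refl))
≢⇒CycleAdj3 {suc zero}         {zero}             _   = inj₁ (inj₂ refl)
≢⇒CycleAdj3 {suc zero}         {suc zero}         i≢j = ⊥-elim (i≢j refl)
≢⇒CycleAdj3 {suc zero}         {suc (suc zero)}   _   = inj₁ (inj₁ refl)
≢⇒CycleAdj3 {suc (suc zero)}   {zero}             _   = inj₂ (inj₁ (refl , refl))
≢⇒CycleAdj3 {suc (suc zero)}   {suc zero}         _   = inj₁ (inj₂ refl)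
≢⇒CycleAdj3 {suc (suc zero)}   {suc (suc zero)}   i≢j = ⊥-elim (i≢j refl)

starListing-LineAdj⇔CycleAdj3 : ∀ i j → LineAdj starListing i j ⇔ CycleAdj 3 i j
starListing-LineAdj⇔CycleAdj3 i j =
  mk⇔ (≢⇒CycleAdj3 ∘ proj₁)
      λ ij → Adj⇒≢ (cycleGraph 1) ij , zero , x∈pair {y = suc i} , x∈pair {y = suc j}

cycle-isTSReconf : ∀ n → 3 ≤ n → ∀ k → IsTSReconfGraph (k + 2) n (CycleAdj n)
cycle-isTSReconf 1 (s≤s ())
cycle-isTSReconf 2 (s≤s (s≤s ()))
cycle-isTSReconf 3 _ =
  lineGraph-isTSReconf StarAdj? starGraph-triangleFree starListing starListing-LineAdj⇔CycleAdj3
cycle-isTSReconf (suc (suc (suc (suc m)))) _ = cycle≥4-isTSReconf m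

isTSReconf-k≥2 : ∀ {n R} → (∀ k → IsTSReconfGraph (k + 2) n R) → ∀ {k} → 2 ≤ k → IsTSReconfGraph k n R
isTSReconf-k≥2 {n} {R} isTSReconf {k} 2≤k =
  subst (λ k → IsTSReconfGraph k n R) (m∸n+n≡m 2≤k) (isTSReconf (k ∸ 2))

corollary2 :
    ((k n : ℕ) → 2 ≤ k → 1 ≤ n → IsTSReconfGraph k n (PathAdj n)) ×
    ((k n : ℕ) → 2 ≤ k → 3 ≤ n → IsTSReconfGraph k n (CycleAdj n))
corollary2 = (λ k n 2≤k _ → isTSReconf-k≥2 (path-isTSReconf n) 2≤k)
           , (λ k n 2≤k 3≤n → isTSReconf-k≥2 (cycle-isTSReconf n 3≤n) 2≤k)
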